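{- Let $M_h$ be a model of a high-level BAT $\mathcal{D}_h$ and $M_l$ a model of $\mathcal{D}_l\cup\mathcal{C}$ for a low-level BAT $\mathcal{D}_l$, let $m$ be a refinement mapping from $\mathcal{D}_h$ to $\mathcal{D}_l$, and suppose $M_h\sim_m M_l$. Then for any sequence of ground high-level actions $\vec\alpha$ and any high-level situation-suppressed formula $\phi$: $M_l\models\exists s'.\,Do(m(\vec\alpha),S_0,s')\land m(\phi)[s']$ if and only if $M_h\models Executable(do(\vec\alpha,S_0))\land\phi[do(\vec\alpha,S_0)]$.
   Context: Situation calculus setting. Objects are a countably infinite set $\mathcal{N}$ of standard names (unique names and domain closure); no function symbols other than constants; no non-fluent predicates. Situations: $S_0$ and $do(a,s)$; $do([a_1,\dots,a_n],s)$ abbreviates $do(a_n,\dots,do(a_1,s)\dots)$, also written $do(\vec a,s)$. $Poss(a,s)$ means $a$ is executable in $s$; $Executable(s)$ means every action along the history from $S_0$ to $s$ was possible where performed. A basic action theory (BAT) over finitely many action types $\mathcal{A}$ and fluents $\mathcal{F}$ consists of initial-state axioms $\mathcal{D}_{S_0}$, precondition axioms $Poss(A(\vec x),s)\equiv\phi^{Poss}_A(\vec x,s)$, successor state axioms $F(\vec x,do(a,s))\equiv\phi^{ssa}_F(\vec x,a,s)$ (right-hand sides uniform in $s$), unique names/domain closure axioms for actions $\mathcal{D}_{ca}$ and for objects $\mathcal{D}_{coa}$, and foundational axioms $\Sigma$. A situation-suppressed formula omits situation arguments of fluents; $\phi[s]$ restores $s$. ConGolog programs $\delta::=\alpha\mid\varphi?\mid\delta_1;\delta_2\mid\delta_1|\delta_2\mid\pi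 x.\delta\mid\delta^*\mid\delta_1\|\delta_2$, $nil=True?$; $\mathcal{C}$ are the axioms: $Trans(\alpha,s,\delta',s')\equiv s'=do(\alpha,s)\land Poss(\alpha,s)\land\delta'=True?$; $Trans(\varphi?,s,\delta',s')\equiv False$; $Trans(\delta_1;\delta_2,s,\delta',s')\equiv\exists\delta_1'(Trans(\delta_1,s,\delta_1',s')\land\delta'=\delta_1';\delta_2)\lor(Final(\delta_1,s)\land Trans(\delta_2,s,\delta',s'))$; $Trans(\delta_1|\delta_2,\cdot)\equiv Trans(\delta_1,\cdot)\lor Trans(\delta_2,\cdot)$; $Trans(\pi x.\delta,s,\delta',s')\equiv\exists x.Trans(\delta,s,\delta',s')$; $Trans(\delta^*,s,\delta',s')\equiv\exists\delta''(Trans(\delta,s,\delta'',s')\land\delta'=\delta'';\delta^*)$; $Trans(\delta_1\|\delta_2,s,\delta',s')\equiv\exists\delta_1'(Trans(\delta_1,s,\delta_1',s')\land\delta'=\delta_1'\|\delta_2)\lor\exists\delta_2'(Trans(\delta_2,s,\delta_2',s')\land\delta'=\delta_1\|\delta_2')$; $Final(\alpha,s)\equiv False$; $Final(\varphi?,s)\equiv\varphi[s]$; $Final(\delta_1;\delta_2,s)\equiv Final(\delta_1,s)\land Final(\delta_2,s)$; $Final(\delta_1|\delta_2,s)\equiv Final(\delta_1,s)\lor Final(\delta_2,s)$; $Final(\pi x.\delta,s)\equiv\exists x.Final(\delta,s)$; $Final(\delta^*,s)\equiv True$; $Final(\delta_1\|\delta_2,s)\equiv Final(\delta_1,s)\land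 Final(\delta_2,s)$. $Do(\delta,s,s')\doteq\exists\delta'.Trans^*(\delta,s,\delta',s')\land Final(\delta',s')$, $Trans^*$ the reflexive transitive closure. $\mathcal{D}_h$, $\mathcal{D}_l$ have action types $\mathcal{A}_h,\mathcal{A}_l$ and fluents $\mathcal{F}_h,\mathcal{F}_l$, sharing only $\mathcal{N}$. A refinement mapping $m$ maps each $A\in\mathcal{A}_h$ to a situation-determined ConGolog program $m(A(\vec x))$ over $\mathcal{D}_l$ with free variables $\vec x$ (situation-determined: the remaining program after any sequence of transitions is determined by the resulting situation), and each $F\in\mathcal{F}_h$ to a situation-suppressed low-level formula $m(F(\vec x))$; $m(\phi)$ substitutes $m(F(\vec x))$ for fluent atoms in $\phi$; $m(\alpha_1,\dots,\alpha_n)=m(\alpha_1);\dots;m(\alpha_n)$, $m(\epsilon)=nil$. $s_h\simeq_m^{M_h,M_l}s_l$ ($m$-isomorphic) iff for all $F\in\mathcal{F}_h$ and assignments $v$, $M_h,v[s/s_h]\models F(\vec x,s)$ iff $M_l,v[s/s_l]\models m(F(\vec x))[s]$. A relation $B$ between situation domains of $M_h$ and $M_l$ is an $m$-bisimulation if each $\langle s_h,s_l\rangle\in B$ satisfies: (1) $s_h\simeq_m^{M_h,M_l}s_l$; (2) for each $A\in\mathcal{A}_h$ and $v$, if some $s_h'$ has $M_h,v[s/s_h,s'/s_h']\models Poss(A(\vec x),s)\land s'=do(A(\vec x),s)$ then some $s_l'$ has $M_l,v[s/s_l,s'/s_l']\models Do(m(A(\vec x)),s,s')$ and $\langle s_h',s_l'\rangle\in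 B$; (3) for each $A\in\mathcal{A}_h$ and $v$, if some $s_l'$ has $M_l,v[s/s_l,s'/s_l']\models Do(m(A(\vec x)),s,s')$ then some $s_h'$ has $M_h,v[s/s_h,s'/s_h']\models Poss(A(\vec x),s)\land s'=do(A(\vec x),s)$ and $\langle s_h',s_l'\rangle\in B$. $M_h\sim_m M_l$ iff some $m$-bisimulation contains $\langle S_0^{M_h},S_0^{M_l}\rangle$. -}

module Defs where

open import Level using (Level)
open import Data.Nat using (ℕ; zero; suc; _<_)
open import Data.Fin using (Fin; toℕ)
open import Data.Vec using (Vec; []; _∷_; tabulate)
import Data.Vec as V
open import Data.List using (List; []; _∷_)
open import Data.List.Membership.Propositional using (_∈_)
open import Data.Maybe using (Maybe; just; nothing)
open import Data.Product using (Σ; _×_; _,_; Σ-syntax)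
open import Data.Empty using (⊥)
open import Data.Unit using (⊤)
open import Relation.Nullary using (¬_)
open import Relation.Binary.PropositionalEquality using (_≡_)
open import Function.Bundles using (_⇔_)

-- Signatures: finitely many symbols (action types / fluents), each with
-- an arity (all arguments are of sort object).

record Sig : Set where
  field
    size  : ℕ
    arity : Fin size → ℕ
open Sig public

-- the empty signature (used as "no action symbols" for ordinary
-- situation-suppressed formulas)
noActs : Sig
noActs = record { size = 0 ; arity = λ () }

-- Objects are the standard names 𝒩, identified with ℕ (unique names and
-- domain closure for objects).  Object terms: de Bruijn variables or
-- standard names (no other function symbols).

data Term : Set where
  var : ℕ → Term
  nm  : ℕ → Term

Env : Set
Env = ℕ → ℕ

_∷ₑ_ : ℕ → Env → Env
(n ∷ₑ v) zero    = n
(n ∷ₑ v) (suc i) = v i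

evalT : Env → Term → ℕ
evalT v (var i) = v i
evalT v (nm n)  = n

evalTs : ∀ {k} → Env → Vec Term k → Vec ℕ k
evalTs v ts = V.map (evalT v) ts

-- the values of the variables x₁..xₖ (de Bruijn 0..k-1) under v
vecOf : (k : ℕ) → Env → Vec ℕ k
vecOf k v = tabulate (λ i → v (toℕ i))

-- Ground actions A(n⃗) (domain closure + unique names for actions) and
-- situations (foundational axioms Σ: situations are exactly the finite
-- sequences of actions; do(a,s) = a ∷ s, S₀ = []).

GAct : Sig → Set
GAct AS = Σ[ A ∈ Fin (size AS) ] Vec ℕ (arity AS A)

Sit : Sig → Set
Sit AS = List (GAct AS)

S₀ : ∀ {AS} → Sit AS
S₀ = []

doA : ∀ {AS} → GAct AS → Sit AS → Sit AS
doA a s = a ∷ s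

doL : ∀ {AS} → List (GAct AS) → Sit AS → Sit AS
doL []       s = s
doL (a ∷ as) s = doL as (doA a s)

-- The action signature AS is only used by the atom  actIs A t⃗, meaning
-- "the distinguished action variable a equals A(t⃗)"; it is needed for the
-- right-hand sides of successor state axioms.  Ordinary situation-
-- suppressed formulas are  Fml FS noActs.  ex binds de Bruijn variable 0.

data Fml (FS AS : Sig) : Set where
  tru   : Fml FS AS
  fl    : (F : Fin (size FS)) → Vec Term (arity FS F) → Fml FS AS
  eq    : Term → Term → Fml FS AS
  actIs : (A : Fin (size AS)) → Vec Term (arity AS A) → Fml FS AS
  neg   : Fml FS AS → Fml FS AS
  and   : Fml FS AS → Fml FS AS → Fml FS AS
  ex    : Fml FS AS → Fml FS AS

FlVal : Sig → Set₁
FlVal FS = (F : Fin (size FS)) → Vec ℕ (arity FS F) → Set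

⟦_⟧ : ∀ {FS AS} → Fml FS AS → FlVal FS → Env → Maybe (GAct AS) → Set
⟦ tru ⟧        I v a = ⊤
⟦ fl F ts ⟧    I v a = I F (evalTs v ts)
⟦ eq t u ⟧     I v a = evalT v t ≡ evalT v u
⟦ actIs A ts ⟧ I v nothing  = ⊥
⟦ actIs A ts ⟧ I v (just b) = (A , evalTs v ts) ≡ b
⟦ neg φ ⟧      I v a = ¬ ⟦ φ ⟧ I v a
⟦ and φ ψ ⟧    I v a = ⟦ φ ⟧ I v a × ⟦ ψ ⟧ I v a
⟦ ex φ ⟧       I v a = Σ[ n ∈ ℕ ] ⟦ φ ⟧ I (n ∷ₑ v) a

BoundT : ℕ → Term → Set
BoundT k (var i) = i < k
BoundT k (nm _)  = ⊤

BoundTs : ∀ {n} → ℕ → Vec Term n → Set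
BoundTs k []       = ⊤
BoundTs k (t ∷ ts) = BoundT k t × BoundTs k ts

BoundF : ∀ {FS AS} → ℕ → Fml FS AS → Set
BoundF k tru          = ⊤
BoundF k (fl F ts)    = BoundTs k ts
BoundF k (eq t u)     = BoundT k t × BoundT k u
BoundF k (actIs A ts) = BoundTs k ts
BoundF k (neg φ)      = BoundF k φ
BoundF k (and φ ψ)    = BoundF k φ × BoundF k ψ
BoundF k (ex φ)       = BoundF (suc k) φ

-- Interpretations (models of Σ ∪ 𝒟_ca ∪ 𝒟_coa, up to isomorphism):
-- interpretation of each fluent and of Poss on ground actions/situations.

record Structure (FS AS : Sig) : Set₁ where
  field
    Fl   : (F : Fin (size FS)) → Vec ℕ (arity FS F) → Sit AS → Set
    Poss : GAct AS → Sit AS → Set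
open Structure public

at : ∀ {FS AS} → Structure FS AS → Sit AS → FlVal FS
at M s F ns = Fl M F ns s

holds : ∀ {FS AS} → Structure FS AS → Fml FS noActs → Env → Sit AS → Set
holds M φ v s = ⟦ φ ⟧ (at M s) v nothing

Executable : ∀ {FS AS} → Structure FS AS → Sit AS → Set
Executable M []      = ⊤
Executable M (a ∷ s) = Executable M s × Poss M a s

-- Basic action theories (the parts beyond Σ, 𝒟_ca, 𝒟_coa).
-- Precondition axiom for A:  Poss(A(x⃗),s) ≡ poss A   (free vars x⃗ = 0..k-1)
-- SSA for F:  F(x⃗,do(a,s)) ≡ ssa F   (free vars x⃗ and the action var a)

record BAT (FS AS : Sig) : Set where
  field
    init     : List (Fml FS noActs)
    init-cl  : ∀ φ → φ ∈ init → BoundF 0 φ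
    poss     : (A : Fin (size AS)) → Fml FS noActs
    poss-fv  : ∀ A → BoundF (arity AS A) (poss A)
    ssa      : (F : Fin (size FS)) → Fml FS AS
    ssa-fv   : ∀ F → BoundF (arity FS F) (ssa F)
open BAT public

record ModelOf {FS AS} (D : BAT FS AS) (M : Structure FS AS) : Set where
  field
    sat-init : ∀ φ → φ ∈ init D → ∀ v → holds M φ v S₀
    sat-poss : ∀ A v s → Poss M (A , vecOf (arity AS A) v) s ⇔ holds M (poss D A) v s
    sat-ssa  : ∀ F v a s →
               Fl M F (vecOf (arity FS F) v) (doA a s) ⇔ ⟦ ssa D F ⟧ (at M s) v (just a)

shiftT : Term → Term
shiftT (var i) = var (suc i)
shiftT (nm n)  = nm n

Subst : Set
Subst = ℕ → Term

liftS : Subst → Subst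
liftS σ zero    = var zero
liftS σ (suc i) = shiftT (σ i)

substT : Subst → Term → Term
substT σ (var i) = σ i
substT σ (nm n)  = nm n

substF : ∀ {FS AS} → Subst → Fml FS AS → Fml FS AS
substF σ tru          = tru
substF σ (fl F ts)    = fl F (V.map (substT σ) ts)
substF σ (eq t u)     = eq (substT σ t) (substT σ u)
substF σ (actIs A ts) = actIs A (V.map (substT σ) ts)
substF σ (neg φ)      = neg (substF σ φ)
substF σ (and φ ψ)    = and (substF σ φ) (substF σ ψ)
substF σ (ex φ)       = ex (substF (liftS σ) φ)

-- substitute t⃗ for x₁..xₖ (remaining variables shifted down by k)
vecSubst : ∀ {k} → Vec Term k → Subst
vecSubst []       i       = var i
vecSubst (t ∷ ts) zero    = t
vecSubst (t ∷ ts) (suc i) = vecSubst ts i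

-- ConGolog programs over (FS, AS); pick (π) binds de Bruijn variable 0.

data Prog (FS AS : Sig) : Set where
  act    : (A : Fin (size AS)) → Vec Term (arity AS A) → Prog FS AS
  test   : Fml FS noActs → Prog FS AS
  seq    : Prog FS AS → Prog FS AS → Prog FS AS
  choice : Prog FS AS → Prog FS AS → Prog FS AS
  pick   : Prog FS AS → Prog FS AS
  star   : Prog FS AS → Prog FS AS
  conc   : Prog FS AS → Prog FS AS → Prog FS AS

nil : ∀ {FS AS} → Prog FS AS
nil = test tru

substP : ∀ {FS AS} → Subst → Prog FS AS → Prog FS AS
substP σ (act A ts)     = act A (V.map (substT σ) ts)
substP σ (test φ)       = test (substF σ φ)
substP σ (seq δ₁ δ₂)    = seq (substP σ δ₁) (substP σ δ₂)
substP σ (choice δ₁ δ₂) = choice (substP σ δ₁) (substP σ δ₂)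
substP σ (pick δ)       = pick (substP (liftS σ) δ)
substP σ (star δ)       = star (substP σ δ)
substP σ (conc δ₁ δ₂)   = conc (substP σ δ₁) (substP σ δ₂)

inst : ∀ {FS AS} → ℕ → Prog FS AS → Prog FS AS
inst n δ = substP (vecSubst (nm n ∷ [])) δ

BoundP : ∀ {FS AS} → ℕ → Prog FS AS → Set
BoundP k (act A ts)     = BoundTs k ts
BoundP k (test φ)       = BoundF k φ
BoundP k (seq δ₁ δ₂)    = BoundP k δ₁ × BoundP k δ₂
BoundP k (choice δ₁ δ₂) = BoundP k δ₁ × BoundP k δ₂
BoundP k (pick δ)       = BoundP (suc k) δ
BoundP k (star δ)       = BoundP k δ
BoundP k (conc δ₁ δ₂)   = BoundP k δ₁ × BoundP k δ₂

-- The axioms 𝒞 (Trans / Final), interpreted in a structure M, under an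
-- assignment v for the free variables of the program.

module _ {FS AS : Sig} (M : Structure FS AS) (v : Env) where

  data Final : Prog FS AS → Sit AS → Set where
    f-test    : ∀ {φ s} → holds M φ v s → Final (test φ) s
    f-seq     : ∀ {δ₁ δ₂ s} → Final δ₁ s → Final δ₂ s → Final (seq δ₁ δ₂) s
    f-choiceˡ : ∀ {δ₁ δ₂ s} → Final δ₁ s → Final (choice δ₁ δ₂) s
    f-choiceʳ : ∀ {δ₁ δ₂ s} → Final δ₂ s → Final (choice δ₁ δ₂) s
    f-pick    : ∀ {δ s} (n : ℕ) → Final (inst n δ) s → Final (pick δ) s
    f-star    : ∀ {δ s} → Final (star δ) s
    f-conc    : ∀ {δ₁ δ₂ s} → Final δ₁ s → Final δ₂ s → Final (conc δ₁ δ₂) s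

  data Trans : Prog FS AS → Sit AS → Prog FS AS → Sit AS → Set where
    t-act     : ∀ {A ts s} → Poss M (A , evalTs v ts) s →
                Trans (act A ts) s nil (doA (A , evalTs v ts) s)
    t-seqˡ    : ∀ {δ₁ δ₁' δ₂ s s'} → Trans δ₁ s δ₁' s' →
                Trans (seq δ₁ δ₂) s (seq δ₁' δ₂) s'
    t-seqʳ    : ∀ {δ₁ δ₂ δ' s s'} → Final δ₁ s → Trans δ₂ s δ' s' →
                Trans (seq δ₁ δ₂) s δ' s'
    t-choiceˡ : ∀ {δ₁ δ₂ δ' s s'} → Trans δ₁ s δ' s' → Trans (choice δ₁ δ₂) s δ' s'
    t-choiceʳ : ∀ {δ₁ δ₂ δ' s s'} → Trans δ₂ s δ' s' → Trans (choice δ₁ δ₂) s δ' s'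
    t-pick    : ∀ {δ δ' s s'} (n : ℕ) → Trans (inst n δ) s δ' s' →
                Trans (pick δ) s δ' s'
    t-star    : ∀ {δ δ'' s s'} → Trans δ s δ'' s' →
                Trans (star δ) s (seq δ'' (star δ)) s'
    t-concˡ   : ∀ {δ₁ δ₁' δ₂ s s'} → Trans δ₁ s δ₁' s' →
                Trans (conc δ₁ δ₂) s (conc δ₁' δ₂) s'
    t-concʳ   : ∀ {δ₁ δ₂ δ₂' s s'} → Trans δ₂ s δ₂' s' →
                Trans (conc δ₁ δ₂) s (conc δ₁ δ₂') s'

  data Trans* : Prog FS AS → Sit AS → Prog FS AS → Sit AS → Set where
    t-refl : ∀ {δ s} → Trans* δ s δ s
    t-step : ∀ {δ s δ' s' δ'' s''} → Trans δ s δ' s' → Trans* δ' s' δ'' s'' →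
             Trans* δ s δ'' s''

  Do : Prog FS AS → Sit AS → Sit AS → Set
  Do δ s s' = Σ[ δ' ∈ Prog FS AS ] (Trans* δ s δ' s' × Final δ' s')

SitDetermined : ∀ {FS AS} → Structure FS AS → Env → Prog FS AS → Sit AS → Set
SitDetermined M v δ s = ∀ {s' δ' δ''} → Trans* M v δ s δ' s' → Trans* M v δ s δ'' s' → δ' ≡ δ''

record Refinement {FH AH FL AL : Sig} (Dh : BAT FH AH) (Dl : BAT FL AL) : Set₁ where
  field
    mA    : (A : Fin (size AH)) → Prog FL AL          -- m(A(x⃗)), x⃗ = vars 0..k-1
    mA-fv : ∀ A → BoundP (arity AH A) (mA A)
    mA-sd : ∀ A (M : Structure FL AL) → ModelOf Dl M → ∀ v s → SitDetermined M v (mA A) s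
    mF    : (F : Fin (size FH)) → Fml FL noActs
    mF-fv : ∀ F → BoundF (arity FH F) (mF F)
open Refinement public

module _ {FH AH FL AL : Sig} {Dh : BAT FH AH} {Dl : BAT FL AL} (m : Refinement Dh Dl) where

  mFml : Fml FH noActs → Fml FL noActs
  mFml tru         = tru
  mFml (fl F ts)   = substF (vecSubst ts) (mF m F)
  mFml (eq t u)    = eq t u
  mFml (actIs () ts)
  mFml (neg φ)     = neg (mFml φ)
  mFml (and φ ψ)   = and (mFml φ) (mFml ψ)
  mFml (ex φ)      = ex (mFml φ)

  mAct : GAct AH → Prog FL AL
  mAct (A , ns) = substP (vecSubst (V.map nm ns)) (mA m A)

  mSeq : List (GAct AH) → Prog FL AL
  mSeq []           = nil
  mSeq (α ∷ [])     = mAct α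
  mSeq (α ∷ β ∷ αs) = seq (mAct α) (mSeq (β ∷ αs))

  Iso : Structure FH AH → Structure FL AL → Sit AH → Sit AL → Set
  Iso Mh Ml sh sl = ∀ F v → Fl Mh F (vecOf (arity FH F) v) sh ⇔ holds Ml (mF m F) v sl

  record IsBisim (Mh : Structure FH AH) (Ml : Structure FL AL)
                 (B : Sit AH → Sit AL → Set) : Set where
    field
      iso   : ∀ {sh sl} → B sh sl → Iso Mh Ml sh sl
      forth : ∀ {sh sl} → B sh sl → ∀ A v sh' →
              Poss Mh (A , vecOf (arity AH A) v) sh × sh' ≡ doA (A , vecOf (arity AH A) v) sh →
              Σ[ sl' ∈ Sit AL ] (Do Ml v (mA m A) sl sl' × B sh' sl')
      back  : ∀ {sh sl} → B sh sl → ∀ A v sl' →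
              Do Ml v (mA m A) sl sl' →
              Σ[ sh' ∈ Sit AH ] ((Poss Mh (A , vecOf (arity AH A) v) sh ×
                                  sh' ≡ doA (A , vecOf (arity AH A) v) sh) × B sh' sl')

  Bisimilar : Structure FH AH → Structure FL AL → Set₁
  Bisimilar Mh Ml = Σ[ B ∈ (Sit AH → Sit AL → Set) ] (IsBisim Mh Ml B × B S₀ S₀)

module Submission where

-- Let B be the m-bisimulation with B S₀ S₀.  Its forth clause matches an executable high-level
-- run do(α⃗, S₀) action by action with a run of m(α₁);…;m(αₙ) ending in a B-related situation,
-- and its back clause turns every such low-level run into an executable high-level one.
-- B-related situations are m-isomorphic, and m-isomorphism lifts from fluent atoms to every
-- formula φ by induction on φ.  The bisimulation speaks about m(A(x⃗)) under an assignment
-- x⃗ ↦ n⃗, whereas m(α⃗) contains the instance m(A(n⃗)); a substitution lemma for Do bridges the two.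

open import Defs
open import Data.List using (List; []; _∷_)
open import Data.Nat using (ℕ; zero; suc)
open import Data.Product using (_×_; Σ-syntax; _,_; proj₁; proj₂)
import Data.Product.Function.Dependent.Propositional as Σ
open import Data.Product.Function.NonDependent.Propositional using (_×-⇔_)
open import Data.Unit using (tt)
open import Data.Vec using (Vec; []; _∷_)
import Data.Vec as V
import Data.Vec.Properties as V
open import Data.Maybe using (just; nothing)
open import Function using (_∘_)
open import Function.Bundles using (_⇔_; mk⇔; Equivalence)
open import Function.Construct.Identity using (⇔-id)
open import Function.Construct.Symmetry using (⇔-sym)
open import Function.Related.Propositional using (equivalence; ≡⇒; module EquationalReasoning)
open import Function.Related.TypeIsomorphisms using (¬-cong-⇔)
open import Relation.Binary.PropositionalEquality

open Equivalence using (to; from)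

evalS : Subst → Env → Env
evalS σ v i = evalT v (σ i)

evalT-substT : ∀ {σ v w} → evalS σ v ≗ w → ∀ t → evalT v (substT σ t) ≡ evalT w t
evalT-substT e (var i) = e i
evalT-substT e (nm n)  = refl

evalTs-substTs : ∀ {σ v w k} → evalS σ v ≗ w → (ts : Vec Term k) →
                 evalTs v (V.map (substT σ) ts) ≡ evalTs w ts
evalTs-substTs {σ} {v} e ts =
  trans (sym (V.map-∘ (evalT v) (substT σ) ts)) (V.map-cong (evalT-substT e) ts)

vecOf-vecSubst : ∀ {k} (ts : Vec Term k) v → vecOf k (evalS (vecSubst ts) v) ≡ evalTs v ts
vecOf-vecSubst []       v = refl
vecOf-vecSubst (t ∷ ts) v = cong (evalT v t ∷_) (vecOf-vecSubst ts v)

evalTs-nm : ∀ {k} v (ns : Vec ℕ k) → evalTs v (V.map nm ns) ≡ ns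
evalTs-nm v ns = trans (sym (V.map-∘ (evalT v) nm ns)) (V.map-id ns)

evalT-shiftT : ∀ n v t → evalT (n ∷ₑ v) (shiftT t) ≡ evalT v t
evalT-shiftT n v (var i) = refl
evalT-shiftT n v (nm k)  = refl

evalS-liftS : ∀ {σ v w} → evalS σ v ≗ w → ∀ n → evalS (liftS σ) (n ∷ₑ v) ≗ (n ∷ₑ w)
evalS-liftS e n zero    = refl
evalS-liftS {σ} {v} e n (suc i) = trans (evalT-shiftT n v (σ i)) (e i)

⟦⟧-substF : ∀ {FS AS σ v w} I a → evalS σ v ≗ w → (φ : Fml FS AS) →
            ⟦ substF σ φ ⟧ I v a ⇔ ⟦ φ ⟧ I w a
⟦⟧-substF I a e tru = ⇔-id _
⟦⟧-substF I a e (fl F ts) = ≡⇒ (cong (I F) (evalTs-substTs e ts))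
⟦⟧-substF I a e (eq t u) = ≡⇒ (cong₂ _≡_ (evalT-substT e t) (evalT-substT e u))
⟦⟧-substF I nothing e (actIs A ts) = ⇔-id _
⟦⟧-substF I (just b) e (actIs A ts) = ≡⇒ (cong (λ ns → (A , ns) ≡ b) (evalTs-substTs e ts))
⟦⟧-substF I a e (neg φ) = ¬-cong-⇔ (⟦⟧-substF I a e φ)
⟦⟧-substF I a e (and φ ψ) = ⟦⟧-substF I a e φ ×-⇔ ⟦⟧-substF I a e ψ
⟦⟧-substF I a e (ex φ) = Σ.congˡ {k = equivalence} λ {n} → ⟦⟧-substF I a (evalS-liftS e n) φ

_∘ₛ_ : Subst → Subst → Subst
(τ ∘ₛ σ) i = substT τ (σ i)

substT-shiftT : ∀ τ t → substT (liftS τ) (shiftT t) ≡ shiftT (substT τ t)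
substT-shiftT τ (var i) = refl
substT-shiftT τ (nm n)  = refl

liftS-∘ : ∀ {τ σ ρ} → τ ∘ₛ σ ≗ ρ → liftS τ ∘ₛ liftS σ ≗ liftS ρ
liftS-∘ e zero = refl
liftS-∘ {τ} {σ} e (suc i) = trans (substT-shiftT τ (σ i)) (cong shiftT (e i))

substT-∘ : ∀ {τ σ ρ} → τ ∘ₛ σ ≗ ρ → ∀ t → substT τ (substT σ t) ≡ substT ρ t
substT-∘ e (var i) = e i
substT-∘ e (nm n)  = refl

substTs-∘ : ∀ {τ σ ρ k} → τ ∘ₛ σ ≗ ρ → (ts : Vec Term k) →
            V.map (substT τ) (V.map (substT σ) ts) ≡ V.map (substT ρ) ts
substTs-∘ {τ} {σ} e ts = trans (sym (V.map-∘ (substT τ) (substT σ) ts)) (V.map-cong (substT-∘ e) ts)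

substF-∘ : ∀ {FS AS τ σ ρ} → τ ∘ₛ σ ≗ ρ → (φ : Fml FS AS) → substF τ (substF σ φ) ≡ substF ρ φ
substF-∘ e tru          = refl
substF-∘ e (fl F ts)    = cong (fl F) (substTs-∘ e ts)
substF-∘ e (eq t u)     = cong₂ eq (substT-∘ e t) (substT-∘ e u)
substF-∘ e (actIs A ts) = cong (actIs A) (substTs-∘ e ts)
substF-∘ e (neg φ)      = cong neg (substF-∘ e φ)
substF-∘ e (and φ ψ)    = cong₂ and (substF-∘ e φ) (substF-∘ e ψ)
substF-∘ e (ex φ)       = cong ex (substF-∘ (liftS-∘ e) φ)

substP-∘ : ∀ {FS AS τ σ ρ} → τ ∘ₛ σ ≗ ρ → (δ : Prog FS AS) → substP τ (substP σ δ) ≡ substP ρ δ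
substP-∘ e (act A ts)     = cong (act A) (substTs-∘ e ts)
substP-∘ e (test φ)       = cong test (substF-∘ e φ)
substP-∘ e (seq δ₁ δ₂)    = cong₂ seq (substP-∘ e δ₁) (substP-∘ e δ₂)
substP-∘ e (choice δ₁ δ₂) = cong₂ choice (substP-∘ e δ₁) (substP-∘ e δ₂)
substP-∘ e (pick δ)       = cong pick (substP-∘ (liftS-∘ e) δ)
substP-∘ e (star δ)       = cong star (substP-∘ e δ)
substP-∘ e (conc δ₁ δ₂)   = cong₂ conc (substP-∘ e δ₁) (substP-∘ e δ₂)

liftS-var : ∀ {σ} → σ ≗ var → liftS σ ≗ var
liftS-var e zero    = refl
liftS-var e (suc i) = cong shiftT (e i)

substT-var : ∀ {σ} → σ ≗ var → ∀ t → substT σ t ≡ t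
substT-var e (var i) = e i
substT-var e (nm n)  = refl

substTs-var : ∀ {σ k} → σ ≗ var → (ts : Vec Term k) → V.map (substT σ) ts ≡ ts
substTs-var e ts = trans (V.map-cong (substT-var e) ts) (V.map-id ts)

substF-var : ∀ {FS AS σ} → σ ≗ var → (φ : Fml FS AS) → substF σ φ ≡ φ
substF-var e tru          = refl
substF-var e (fl F ts)    = cong (fl F) (substTs-var e ts)
substF-var e (eq t u)     = cong₂ eq (substT-var e t) (substT-var e u)
substF-var e (actIs A ts) = cong (actIs A) (substTs-var e ts)
substF-var e (neg φ)      = cong neg (substF-var e φ)
substF-var e (and φ ψ)    = cong₂ and (substF-var e φ) (substF-var e ψ)
substF-var e (ex φ)       = cong ex (substF-var (liftS-var e) φ)

substP-var : ∀ {FS AS σ} → σ ≗ var → (δ : Prog FS AS) → substP σ δ ≡ δ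
substP-var e (act A ts)     = cong (act A) (substTs-var e ts)
substP-var e (test φ)       = cong test (substF-var e φ)
substP-var e (seq δ₁ δ₂)    = cong₂ seq (substP-var e δ₁) (substP-var e δ₂)
substP-var e (choice δ₁ δ₂) = cong₂ choice (substP-var e δ₁) (substP-var e δ₂)
substP-var e (pick δ)       = cong pick (substP-var (liftS-var e) δ)
substP-var e (star δ)       = cong star (substP-var e δ)
substP-var e (conc δ₁ δ₂)   = cong₂ conc (substP-var e δ₁) (substP-var e δ₂)

instₛ : ℕ → Subst
instₛ n = vecSubst (nm n ∷ [])

substT-instₛ-shiftT : ∀ n t → substT (instₛ n) (shiftT t) ≡ t
substT-instₛ-shiftT n (var i) = refl
substT-instₛ-shiftT n (nm k)  = refl

evalS-instₛ-liftS : ∀ {σ τ v w} → evalS σ v ≗ evalS τ w → ∀ n →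
                    evalS (instₛ n ∘ₛ liftS σ) v ≗ evalS (instₛ n ∘ₛ liftS τ) w
evalS-instₛ-liftS e n zero = refl
evalS-instₛ-liftS {σ} {τ} e n (suc i)
  rewrite substT-instₛ-shiftT n (σ i) | substT-instₛ-shiftT n (τ i) = e i

module _ {FS AS : Sig} (M : Structure FS AS) where

  -- γ under w can mimic every step of δ under v.  Relating substitution instances of one
  -- program is not enough, since a π-step instantiates a bound variable and the residual
  -- program is no longer such an instance; Sim-substP shows that instances are Sim-related.
  data Sim (v w : Env) : Prog FS AS → Prog FS AS → Set where
    act    : ∀ {A ts us} → evalTs v ts ≡ evalTs w us → Sim v w (act A ts) (act A us)
    test   : ∀ {φ ψ} → (∀ s → holds M φ v s → holds M ψ w s) → Sim v w (test φ) (test ψ)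
    seq    : ∀ {δ₁ δ₂ γ₁ γ₂} → Sim v w δ₁ γ₁ → Sim v w δ₂ γ₂ → Sim v w (seq δ₁ δ₂) (seq γ₁ γ₂)
    choice : ∀ {δ₁ δ₂ γ₁ γ₂} → Sim v w δ₁ γ₁ → Sim v w δ₂ γ₂ → Sim v w (choice δ₁ δ₂) (choice γ₁ γ₂)
    pick   : ∀ {δ γ} → (∀ n → Sim v w (inst n δ) (inst n γ)) → Sim v w (pick δ) (pick γ)
    star   : ∀ {δ γ} → Sim v w δ γ → Sim v w (star δ) (star γ)
    conc   : ∀ {δ₁ δ₂ γ₁ γ₂} → Sim v w δ₁ γ₁ → Sim v w δ₂ γ₂ → Sim v w (conc δ₁ δ₂) (conc γ₁ γ₂)

  module _ {v w : Env} where

    Sim-nil : Sim v w nil nil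
    Sim-nil = test λ _ _ → tt

    Final-sim : ∀ {δ γ s} → Sim v w δ γ → Final M v δ s → Final M w γ s
    Final-sim (test h)     (f-test p)    = f-test (h _ p)
    Final-sim (seq r₁ r₂)  (f-seq p q)   = f-seq (Final-sim r₁ p) (Final-sim r₂ q)
    Final-sim (choice r _) (f-choiceˡ p) = f-choiceˡ (Final-sim r p)
    Final-sim (choice _ r) (f-choiceʳ p) = f-choiceʳ (Final-sim r p)
    Final-sim (pick r)     (f-pick n p)  = f-pick n (Final-sim (r n) p)
    Final-sim (star _)     f-star        = f-star
    Final-sim (conc r₁ r₂) (f-conc p q)  = f-conc (Final-sim r₁ p) (Final-sim r₂ q)

    Trans-sim : ∀ {δ γ s δ' s'} → Sim v w δ γ → Trans M v δ s δ' s' →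
                Σ[ γ' ∈ Prog FS AS ] (Trans M w γ s γ' s' × Sim v w δ' γ')
    Trans-sim (act {ts = ts} e) (t-act p) with evalTs v ts | e
    ... | _ | refl = nil , t-act p , Sim-nil
    Trans-sim (seq r₁ r₂) (t-seqˡ d)
      with γ' , t , r ← Trans-sim r₁ d = _ , t-seqˡ t , seq r r₂
    Trans-sim (seq r₁ r₂) (t-seqʳ f d)
      with γ' , t , r ← Trans-sim r₂ d = γ' , t-seqʳ (Final-sim r₁ f) t , r
    Trans-sim (choice r₁ _) (t-choiceˡ d)
      with γ' , t , r ← Trans-sim r₁ d = γ' , t-choiceˡ t , r
    Trans-sim (choice _ r₂) (t-choiceʳ d)
      with γ' , t , r ← Trans-sim r₂ d = γ' , t-choiceʳ t , r
    Trans-sim (pick r) (t-pick n d)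
      with γ' , t , r' ← Trans-sim (r n) d = γ' , t-pick n t , r'
    Trans-sim (star r) (t-star d)
      with γ' , t , r' ← Trans-sim r d = _ , t-star t , seq r' (star r)
    Trans-sim (conc r₁ r₂) (t-concˡ d)
      with γ' , t , r ← Trans-sim r₁ d = _ , t-concˡ t , conc r r₂
    Trans-sim (conc r₁ r₂) (t-concʳ d)
      with γ' , t , r ← Trans-sim r₂ d = _ , t-concʳ t , conc r₁ r

    Trans*-sim : ∀ {δ γ s δ' s'} → Sim v w δ γ → Trans* M v δ s δ' s' →
                 Σ[ γ' ∈ Prog FS AS ] (Trans* M w γ s γ' s' × Sim v w δ' γ')
    Trans*-sim r t-refl = _ , t-refl , r
    Trans*-sim r (t-step d ds)
      with γ₁ , t , r₁ ← Trans-sim r d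
      with γ' , ts , r' ← Trans*-sim r₁ ds = γ' , t-step t ts , r'

    Do-sim : ∀ {δ γ s s'} → Sim v w δ γ → Do M v δ s s' → Do M w γ s s'
    Do-sim r (δ' , ds , f) with γ' , ts , r' ← Trans*-sim r ds = γ' , ts , Final-sim r' f

    Sim-substP : ∀ {σ τ} → evalS σ v ≗ evalS τ w → (δ : Prog FS AS) →
                 Sim v w (substP σ δ) (substP τ δ)
    Sim-substP e (act A ts)     =
      act (trans (evalTs-substTs e ts) (sym (evalTs-substTs (λ _ → refl) ts)))
    Sim-substP e (test φ)       = test λ s →
      from (⟦⟧-substF (at M s) nothing (sym ∘ e) φ) ∘ to (⟦⟧-substF (at M s) nothing (λ _ → refl) φ)
    Sim-substP e (seq δ₁ δ₂)    = seq (Sim-substP e δ₁) (Sim-substP e δ₂)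
    Sim-substP e (choice δ₁ δ₂) = choice (Sim-substP e δ₁) (Sim-substP e δ₂)
    Sim-substP e (pick δ)       = pick λ n →
      subst₂ (Sim v w) (sym (substP-∘ (λ _ → refl) δ)) (sym (substP-∘ (λ _ → refl) δ))
             (Sim-substP (evalS-instₛ-liftS e n) δ)
    Sim-substP e (star δ)       = star (Sim-substP e δ)
    Sim-substP e (conc δ₁ δ₂)   = conc (Sim-substP e δ₁) (Sim-substP e δ₂)

  Do-substP : ∀ {v σ s s'} (δ : Prog FS AS) → Do M v (substP σ δ) s s' ⇔ Do M (evalS σ v) δ s s'
  Do-substP {v} {σ} {s} {s'} δ = mk⇔
    (subst Do-from-s (substP-var (λ _ → refl) δ) ∘ Do-sim (Sim-substP (λ _ → refl) δ))
    (Do-sim (Sim-substP (λ _ → refl) δ) ∘ subst Do-from-s (sym (substP-var (λ _ → refl) δ)))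
    where
    Do-from-s : Prog FS AS → Set
    Do-from-s γ = Do M (evalS σ v) γ s s'

  module _ {v : Env} where

    Trans*-trans : ∀ {δ₁ s₁ δ₂ s₂ δ₃ s₃} →
                   Trans* M v δ₁ s₁ δ₂ s₂ → Trans* M v δ₂ s₂ δ₃ s₃ → Trans* M v δ₁ s₁ δ₃ s₃
    Trans*-trans t-refl        ds = ds
    Trans*-trans (t-step d ds) es = t-step d (Trans*-trans ds es)

    Trans*-seqˡ : ∀ {δ γ s δ' s'} → Trans* M v δ s δ' s' → Trans* M v (seq δ γ) s (seq δ' γ) s'
    Trans*-seqˡ t-refl        = t-refl
    Trans*-seqˡ (t-step d ds) = t-step (t-seqˡ d) (Trans*-seqˡ ds)

    Do-nil : ∀ {s s'} → Do M v nil s s' ⇔ s' ≡ s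
    Do-nil = mk⇔ (λ { (_ , t-refl , _) → refl ; (_ , t-step () _ , _) })
                 (λ { refl → nil , t-refl , f-test tt })

    Do-seq : ∀ {δ γ s s''} → Do M v (seq δ γ) s s'' ⇔
             (Σ[ s' ∈ Sit AS ] (Do M v δ s s' × Do M v γ s' s''))
    Do-seq = mk⇔ (λ (_ , ds , f) → split ds f) join
      where
      split : ∀ {δ γ s ε s''} → Trans* M v (seq δ γ) s ε s'' → Final M v ε s'' →
              Σ[ s' ∈ Sit AS ] (Do M v δ s s' × Do M v γ s' s'')
      split t-refl (f-seq f g) = _ , (_ , t-refl , f) , (_ , t-refl , g)
      split (t-step (t-seqˡ d) ds) f with s' , (δ' , ds' , f') , dγ ← split ds f =
        s' , (δ' , t-step d ds' , f') , dγ
      split (t-step (t-seqʳ f d) ds) g = _ , (_ , t-refl , f) , (_ , t-step d ds , g)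

      join : ∀ {δ γ s s''} → Σ[ s' ∈ Sit AS ] (Do M v δ s s' × Do M v γ s' s'') →
             Do M v (seq δ γ) s s''
      join (_ , (δ' , ds , f) , (γ' , t-refl , g))      = seq δ' γ' , Trans*-seqˡ ds , f-seq f g
      join (_ , (δ' , ds , f) , (γ' , t-step d es , g)) =
        γ' , Trans*-trans (Trans*-seqˡ ds) (t-step (t-seqʳ f d) es) , g

Executable-prefix : ∀ {FS AS} {M : Structure FS AS} αs {s} → Executable M (doL αs s) → Executable M s
Executable-prefix []       e = e
Executable-prefix (α ∷ αs) e = proj₁ (Executable-prefix αs e)

module Refines {FH AH FL AL : Sig} {Dh : BAT FH AH} {Dl : BAT FL AL} (m : Refinement Dh Dl)
               (Mh : Structure FH AH) (Ml : Structure FL AL) where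

  holds-mFml : ∀ {sh sl} → Iso m Mh Ml sh sl → ∀ φ v → holds Ml (mFml m φ) v sl ⇔ holds Mh φ v sh
  holds-mFml i tru       v = ⇔-id _
  holds-mFml {sh} {sl} i (fl F ts) v = begin
    holds Ml (substF (vecSubst ts) (mF m F)) v sl   ∼⟨ ⟦⟧-substF (at Ml sl) nothing (λ _ → refl) (mF m F) ⟩
    holds Ml (mF m F) (evalS (vecSubst ts) v) sl   ∼⟨ ⇔-sym (i F (evalS (vecSubst ts) v)) ⟩
    Fl Mh F (vecOf _ (evalS (vecSubst ts) v)) sh   ≡⟨ cong (λ ns → Fl Mh F ns sh) (vecOf-vecSubst ts v) ⟩
    Fl Mh F (evalTs v ts) sh                       ∎
    where open EquationalReasoning
  holds-mFml i (eq t u)  v = ⇔-id _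
  holds-mFml i (neg φ)   v = ¬-cong-⇔ (holds-mFml i φ v)
  holds-mFml i (and φ ψ) v = holds-mFml i φ v ×-⇔ holds-mFml i ψ v
  holds-mFml i (ex φ)    v = Σ.congˡ {k = equivalence} λ {n} → holds-mFml i φ (n ∷ₑ v)

  Do-mAct : ∀ A (ns : Vec ℕ (arity AH A)) v →
            Σ[ u ∈ Env ] (vecOf (arity AH A) u ≡ ns ×
                          (∀ {sl sl'} → Do Ml v (mAct m (A , ns)) sl sl' ⇔ Do Ml u (mA m A) sl sl'))
  Do-mAct A ns v =
    evalS σ v , trans (vecOf-vecSubst (V.map nm ns) v) (evalTs-nm v ns) , Do-substP Ml (mA m A)
    where σ = vecSubst (V.map nm ns)

  Do-mSeq-∷ : ∀ {v sl sl''} α αs → Do Ml v (mSeq m (α ∷ αs)) sl sl'' ⇔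
              (Σ[ sl' ∈ Sit AL ] (Do Ml v (mAct m α) sl sl' × Do Ml v (mSeq m αs) sl' sl''))
  Do-mSeq-∷ α []      = mk⇔ (λ d → _ , d , from (Do-nil Ml) refl)
                            (λ (_ , d , n) → subst (Do Ml _ (mAct m α) _) (sym (to (Do-nil Ml) n)) d)
  Do-mSeq-∷ α (β ∷ αs) = Do-seq Ml

  module _ {B : Sit AH → Sit AL → Set} (isB : IsBisim m Mh Ml B) (v : Env) where
    open IsBisim isB

    forth-act : ∀ {sh sl} → B sh sl → ∀ α → Poss Mh α sh →
                Σ[ sl' ∈ Sit AL ] (Do Ml v (mAct m α) sl sl' × B (α ∷ sh) sl')
    forth-act b (A , ns) p with u , refl , d⇔ ← Do-mAct A ns v
      with sl' , d , b' ← forth b A u _ (p , refl) = sl' , from d⇔ d , b'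

    back-act : ∀ {sh sl sl'} → B sh sl → ∀ α → Do Ml v (mAct m α) sl sl' → Poss Mh α sh × B (α ∷ sh) sl'
    back-act b (A , ns) d with u , refl , d⇔ ← Do-mAct A ns v
      with _ , (p , refl) , b' ← back b A u _ (to d⇔ d) = p , b'

    forth* : ∀ αs {sh sl} → B sh sl → Executable Mh (doL αs sh) →
             Σ[ sl' ∈ Sit AL ] (Do Ml v (mSeq m αs) sl sl' × B (doL αs sh) sl')
    forth* []       b e = _ , from (Do-nil Ml) refl , b
    forth* (α ∷ αs) b e
      with sl₁ , d₁ , b₁ ← forth-act b α (proj₂ (Executable-prefix αs e))
      with sl' , d , b' ← forth* αs b₁ e = sl' , from (Do-mSeq-∷ α αs) (sl₁ , d₁ , d) , b'

    back* : ∀ αs {sh sl sl'} → B sh sl → Executable Mh sh → Do Ml v (mSeq m αs) sl sl' →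
            Executable Mh (doL αs sh) × B (doL αs sh) sl'
    back* []       b e d rewrite to (Do-nil Ml) d = e , b
    back* (α ∷ αs) b e d
      with sl₁ , d₁ , d' ← to (Do-mSeq-∷ α αs) d
      with p , b₁ ← back-act b α d₁ = back* αs b₁ (e , p) d'

theorem1 : {FH AH FL AL : Sig} (Dh : BAT FH AH) (Dl : BAT FL AL)
    (Mh : Structure FH AH) (Ml : Structure FL AL) →
    ModelOf Dh Mh → ModelOf Dl Ml →
    (m : Refinement Dh Dl) → Bisimilar m Mh Ml →
    (αs : List (GAct AH)) (φ : Fml FH noActs) (v : Env) →
    (Σ[ s' ∈ Sit AL ] (Do Ml v (mSeq m αs) S₀ s' × holds Ml (mFml m φ) v s'))
      ⇔ (Executable Mh (doL αs S₀) × holds Mh φ v (doL αs S₀))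
theorem1 Dh Dl Mh Ml _ _ m (B , isB , b₀) αs φ v = mk⇔
  (λ (s' , d , h) → let e , b = back* isB v αs b₀ tt d in e , to (holds-mFml (iso b) φ v) h)
  (λ (e , h) → let s' , d , b = forth* isB v αs b₀ e in s' , d , from (holds-mFml (iso b) φ v) h)
  where
  open Refines m Mh Ml
  open IsBisim isB
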